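{- Let $s,s_1$ be integers with $s_1\le s-2$ and let $\mathfrak{V}=\{V_{s_1}\subset V_{s_1+1}\subset\cdots\subset V_s\}$ be a chain of subspaces of $\mathbb{F}_q^n$ with $\dim V_i=i$, such that for all $i$ with $s_1<i<s$, $$V_i=\min_{\preceq_q}\{F:\ V_{i-1}\subset F\subset V_{i+1},\ \dim F=i\}.$$ For $s_1<i\le s$ put $u_i=\min(V_s\setminus V_{i-1})$. Then for all $s_1<i<s$ one has $u_i=\min(V_i\setminus V_{i-1})$ and $V_i=V_{i-1}\oplus\langle u_i\rangle$, and moreover $u_{s_1+1}\prec u_{s_1+2}\prec\cdots\prec u_s$.
   Context: Let $q$ be a prime power. Fix a total order $\prec$ on $\mathbb{F}_q$ with $0\prec1\prec x$ for all $x\in\mathbb{F}_q\setminus\{0,1\}$, extended lexicographically to $\mathbb{F}_q^n$ ($\alpha\prec\beta$ iff $\alpha_i\prec\beta_i$ at the first index where they differ); minima of sets of vectors are with respect to $\prec$. For distinct subspaces $U,V$ of the same dimension, $U\prec_q V$ iff $\min(U\setminus V)\prec\min(V\setminus U)$; $\min_{\preceq_q}$ denotes the least element for this total order. -}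

module Defs where

open import Level using (0ℓ)
open import Data.Nat using (ℕ; zero; suc)
open import Data.Vec using (Vec; []; _∷_; zipWith; map; replicate)
open import Data.List using (List)
open import Data.List.Membership.Propositional using (_∈_)
open import Data.Product using (Σ; ∃; _×_; _,_)
open import Data.Sum using (_⊎_)
open import Data.Empty using (⊥)
open import Relation.Nullary using (¬_)
open import Relation.Binary using (Decidable; IsStrictTotalOrder)
open import Relation.Binary.PropositionalEquality using (_≡_)
open import Algebra.Structures using (IsCommutativeRing)

record FiniteField : Set₁ where
  field
    Carrier : Set
    _+_ _*_ : Carrier → Carrier → Carrier
    -_      : Carrier → Carrier
    0# 1#   : Carrier
    isCommutativeRing : IsCommutativeRing _≡_ _+_ _*_ -_ 0# 1#
    0≢1     : ¬ (0# ≡ 1#)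
    inverse : ∀ x → ¬ (x ≡ 0#) → ∃ λ y → x * y ≡ 1#
    _≟_     : Decidable {A = Carrier} _≡_
    elements : List Carrier
    complete : ∀ x → x ∈ elements

record AdmissibleOrder (𝔽 : FiniteField) : Set₁ where
  open FiniteField 𝔽
  field
    _≺_ : Carrier → Carrier → Set
    isStrictTotalOrder : IsStrictTotalOrder _≡_ _≺_
    0≺1 : 0# ≺ 1#
    1≺x : ∀ x → ¬ (x ≡ 0#) → ¬ (x ≡ 1#) → 1# ≺ x

module _ (𝔽 : FiniteField) where
  open FiniteField 𝔽

  Vector : ℕ → Set
  Vector n = Vec Carrier n

  0v : ∀ {n} → Vector n
  0v = replicate _ 0#

  _+v_ : ∀ {n} → Vector n → Vector n → Vector n
  _+v_ = zipWith _+_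

  _·v_ : ∀ {n} → Carrier → Vector n → Vector n
  c ·v v = map (c *_) v

  lincomb : ∀ {n k} → Vec Carrier k → Vec (Vector n) k → Vector n
  lincomb []       []       = 0v
  lincomb (c ∷ cs) (b ∷ bs) = (c ·v b) +v lincomb cs bs

  InSpan : ∀ {n k} → Vec (Vector n) k → Vector n → Set
  InSpan {k = k} bs v = ∃ λ (cs : Vec Carrier k) → v ≡ lincomb cs bs

  LinIndep : ∀ {n k} → Vec (Vector n) k → Set
  LinIndep {k = k} bs = ∀ (cs : Vec Carrier k) → lincomb cs bs ≡ 0v → cs ≡ replicate _ 0#

  record Subspace (n : ℕ) : Set₁ where
    field
      Mem    : Vector n → Set
      mem-0  : Mem 0v
      mem-+  : ∀ {u v} → Mem u → Mem v → Mem (u +v v)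
      mem-·  : ∀ c {v} → Mem v → Mem (c ·v v)
  open Subspace public

  _⊆_ : ∀ {n} → Subspace n → Subspace n → Set
  U ⊆ V = ∀ v → Mem U v → Mem V v

  _≐_ : ∀ {n} → Subspace n → Subspace n → Set
  U ≐ V = U ⊆ V × V ⊆ U

  HasDim : ∀ {n} → Subspace n → ℕ → Set
  HasDim {n} V d = ∃ λ (bs : Vec (Vector n) d) →
    LinIndep bs × (∀ v → (Mem V v → InSpan bs v) × (InSpan bs v → Mem V v))

  _∖_ : ∀ {n} → Subspace n → Subspace n → Vector n → Set
  (U ∖ V) v = Mem U v × ¬ Mem V v

  IsDirectSumLine : ∀ {n} → Subspace n → Subspace n → Vector n → Set
  IsDirectSumLine W U u =
    (∀ v → Mem W v → ∃ λ w → ∃ λ c → Mem U w × v ≡ w +v (c ·v u)) ×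
    (∀ w c → Mem U w → Mem W (w +v (c ·v u))) ×
    (∀ c → Mem U (c ·v u) → c ·v u ≡ 0v)

  module _ (O : AdmissibleOrder 𝔽) where
    open AdmissibleOrder O

    _≺v_ : ∀ {n} → Vector n → Vector n → Set
    []       ≺v []       = ⊥
    (a ∷ as) ≺v (b ∷ bs) = a ≺ b ⊎ (a ≡ b × as ≺v bs)

    _⪯v_ : ∀ {n} → Vector n → Vector n → Set
    u ⪯v v = u ≺v v ⊎ u ≡ v

    IsMin : ∀ {n} → (Vector n → Set) → Vector n → Set
    IsMin S x = S x × (∀ y → S y → x ⪯v y)

    _≺q_ : ∀ {n} → Subspace n → Subspace n → Set
    U ≺q V = ∃ λ a → ∃ λ b → IsMin (U ∖ V) a × IsMin (V ∖ U) b × a ≺v b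

-- If u = min(V_s ∖ V_a) lay in V_{j+2} ∖ V_{j+1} for some a ≤ j, then F = V_j ⊕ ⟨u⟩ would be a
-- competitor for V_{j+1} between V_j and V_{j+2}; minimality of V_{j+1} yields
-- min(V_{j+1} ∖ F) ≺ min(F ∖ V_{j+1}) ⪯ u, although min(V_{j+1} ∖ F) lies in V_s ∖ V_a.
-- Descending from V_s therefore puts u_{a+1} in V_{a+1}.  Everything else is dimension counting
-- (Steinitz exchange) and the inclusions V_s ∖ V_{i+1} ⊆ V_s ∖ V_i.
module Submission where

open import Defs
open import Data.Nat using (ℕ; suc; _≤_; _<_; _+_)
open import Data.Vec using (Vec; []; _∷_; zipWith)
open import Data.Product using (_×_; ∃; _,_; proj₁; proj₂)
open import Data.Sum using (_⊎_; inj₁; inj₂)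

open import Level using (0ℓ)
open import Algebra.Bundles using (CommutativeSemigroup)
open import Algebra.Structures using (IsCommutativeRing)
import Algebra.Properties.CommutativeSemigroup as CommutativeSemigroupProperties
open import Data.Nat using (zero; z≤n; s≤s; _≤′_; ≤′-refl; ≤′-step; _≤‴_; ≤‴-refl; ≤‴-step)
import Data.Nat.Properties as ℕ
open import Data.Vec.Properties
  using (≡-dec; ∷-injectiveˡ; ∷-injectiveʳ; zipWith-assoc; zipWith-comm; zipWith-identityˡ; zipWith-identityʳ)
open import Data.Vec.Relation.Unary.All as All using (All; []; _∷_)
open import Data.List.Relation.Unary.Any using (any?; satisfied)
open import Data.List.Membership.Propositional using (lose)
open import Data.Empty using (⊥-elim)
open import Relation.Nullary using (¬_; Dec; yes; no)
open import Relation.Nullary.Decidable using (map′; decidable-stable)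
open import Relation.Binary.PropositionalEquality
  using (_≡_; refl; sym; trans; cong; cong₂; subst; module ≡-Reasoning)
open import Relation.Binary.PropositionalEquality.Algebra using (isMagma)
open import Relation.Binary using (IsStrictTotalOrder)

module VectorSpace (𝔽 : FiniteField) where
  open FiniteField 𝔽 renaming (_+_ to infixl 6 _+ᶠ_; _*_ to infixl 7 _*ᶠ_; -_ to infix 8 -ᶠ_)
  open IsCommutativeRing isCommutativeRing
    using (+-assoc; +-comm; +-identityˡ; +-identityʳ; -‿inverseʳ;
           *-assoc; *-comm; *-identityˡ; *-identityʳ; distribˡ; distribʳ; zeroˡ; zeroʳ)
  open ≡-Reasoning

  infixl 6 _⊕_
  infixr 7 _⊙_

  _⊕_ : ∀ {n} → Vector 𝔽 n → Vector 𝔽 n → Vector 𝔽 n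
  _⊕_ = _+v_ 𝔽

  _⊙_ : ∀ {n} → Carrier → Vector 𝔽 n → Vector 𝔽 n
  _⊙_ = _·v_ 𝔽

  𝟎 : ∀ {n} → Vector 𝔽 n
  𝟎 = 0v 𝔽

  lc : ∀ {n k} → Vector 𝔽 k → Vec (Vector 𝔽 n) k → Vector 𝔽 n
  lc = lincomb 𝔽

  ⊕-assoc : ∀ {n} (x y z : Vector 𝔽 n) → (x ⊕ y) ⊕ z ≡ x ⊕ (y ⊕ z)
  ⊕-assoc = zipWith-assoc +-assoc

  ⊕-comm : ∀ {n} (x y : Vector 𝔽 n) → x ⊕ y ≡ y ⊕ x
  ⊕-comm = zipWith-comm +-comm

  ⊕-identityˡ : ∀ {n} (x : Vector 𝔽 n) → 𝟎 ⊕ x ≡ x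
  ⊕-identityˡ = zipWith-identityˡ +-identityˡ

  ⊕-identityʳ : ∀ {n} (x : Vector 𝔽 n) → x ⊕ 𝟎 ≡ x
  ⊕-identityʳ = zipWith-identityʳ +-identityʳ

  ⊕-commutativeSemigroup : ℕ → CommutativeSemigroup 0ℓ 0ℓ
  ⊕-commutativeSemigroup n = record
    { _∙_ = _⊕_ {n}
    ; isCommutativeSemigroup = record
      { isSemigroup = record { isMagma = isMagma _⊕_ ; assoc = ⊕-assoc }
      ; comm = ⊕-comm
      }
    }

  open module ⊕-Properties {n} =
    CommutativeSemigroupProperties (⊕-commutativeSemigroup n)
    using (interchange; xy∙z≈y∙xz)

  ⊙-distribˡ : ∀ {n} c (x y : Vector 𝔽 n) → c ⊙ (x ⊕ y) ≡ c ⊙ x ⊕ c ⊙ y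
  ⊙-distribˡ c []      []      = refl
  ⊙-distribˡ c (a ∷ x) (b ∷ y) = cong₂ _∷_ (distribˡ c a b) (⊙-distribˡ c x y)

  ⊙-distribʳ : ∀ {n} c d (x : Vector 𝔽 n) → (c +ᶠ d) ⊙ x ≡ c ⊙ x ⊕ d ⊙ x
  ⊙-distribʳ c d []      = refl
  ⊙-distribʳ c d (a ∷ x) = cong₂ _∷_ (distribʳ a c d) (⊙-distribʳ c d x)

  ⊙-assoc : ∀ {n} c d (x : Vector 𝔽 n) → c ⊙ d ⊙ x ≡ (c *ᶠ d) ⊙ x
  ⊙-assoc c d []      = refl
  ⊙-assoc c d (a ∷ x) = cong₂ _∷_ (sym (*-assoc c d a)) (⊙-assoc c d x)

  ⊙-identityˡ : ∀ {n} (x : Vector 𝔽 n) → 1# ⊙ x ≡ x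
  ⊙-identityˡ []      = refl
  ⊙-identityˡ (a ∷ x) = cong₂ _∷_ (*-identityˡ a) (⊙-identityˡ x)

  ⊙-zeroˡ : ∀ {n} (x : Vector 𝔽 n) → 0# ⊙ x ≡ 𝟎
  ⊙-zeroˡ []      = refl
  ⊙-zeroˡ (a ∷ x) = cong₂ _∷_ (zeroˡ a) (⊙-zeroˡ x)

  ⊙-zeroʳ : ∀ {n} c → c ⊙ 𝟎 {n} ≡ 𝟎
  ⊙-zeroʳ {zero}  c = refl
  ⊙-zeroʳ {suc n} c = cong₂ _∷_ (zeroʳ c) (⊙-zeroʳ c)

  ⊙-cancel : ∀ {n} {c d} (x : Vector 𝔽 n) → d *ᶠ c ≡ 1# → d ⊙ c ⊙ x ≡ x
  ⊙-cancel {c = c} {d} x dc≡1 = begin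
    d ⊙ c ⊙ x      ≡⟨ ⊙-assoc d c x ⟩
    (d *ᶠ c) ⊙ x   ≡⟨ cong (_⊙ x) dc≡1 ⟩
    1# ⊙ x         ≡⟨ ⊙-identityˡ x ⟩
    x              ∎

  ⊕≡𝟎⇒≡-⊙ : ∀ {n} c (x y : Vector 𝔽 n) → x ⊕ c ⊙ y ≡ 𝟎 → x ≡ (-ᶠ c) ⊙ y
  ⊕≡𝟎⇒≡-⊙ c x y x+cy≡0 = begin
    x                                ≡⟨ sym (⊕-identityʳ x) ⟩
    x ⊕ 𝟎                            ≡⟨ cong (x ⊕_) c-c≡0 ⟨
    x ⊕ (c ⊙ y ⊕ (-ᶠ c) ⊙ y)         ≡⟨ ⊕-assoc x _ _ ⟨
    (x ⊕ c ⊙ y) ⊕ (-ᶠ c) ⊙ y         ≡⟨ cong (_⊕ (-ᶠ c) ⊙ y) x+cy≡0 ⟩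
    𝟎 ⊕ (-ᶠ c) ⊙ y                   ≡⟨ ⊕-identityˡ _ ⟩
    (-ᶠ c) ⊙ y                       ∎
    where
    c-c≡0 : c ⊙ y ⊕ (-ᶠ c) ⊙ y ≡ 𝟎
    c-c≡0 = trans (sym (⊙-distribʳ c (-ᶠ c) y)) (trans (cong (_⊙ y) (-‿inverseʳ c)) (⊙-zeroˡ y))

  lincomb-⊕ : ∀ {n k} (cs ds : Vector 𝔽 k) (bs : Vec (Vector 𝔽 n) k) →
    lc (cs ⊕ ds) bs ≡ lc cs bs ⊕ lc ds bs
  lincomb-⊕ []       []       []       = sym (⊕-identityˡ 𝟎)
  lincomb-⊕ (c ∷ cs) (d ∷ ds) (b ∷ bs) = begin
    (c +ᶠ d) ⊙ b ⊕ lc (cs ⊕ ds) bs            ≡⟨ cong₂ _⊕_ (⊙-distribʳ c d b) (lincomb-⊕ cs ds bs) ⟩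
    (c ⊙ b ⊕ d ⊙ b) ⊕ (lc cs bs ⊕ lc ds bs)   ≡⟨ interchange _ _ _ _ ⟩
    (c ⊙ b ⊕ lc cs bs) ⊕ (d ⊙ b ⊕ lc ds bs)   ∎

  lincomb-⊙ : ∀ {n k} c (cs : Vector 𝔽 k) (bs : Vec (Vector 𝔽 n) k) →
    lc (c ⊙ cs) bs ≡ c ⊙ lc cs bs
  lincomb-⊙ c []       []       = sym (⊙-zeroʳ c)
  lincomb-⊙ c (a ∷ cs) (b ∷ bs) = begin
    (c *ᶠ a) ⊙ b ⊕ lc (c ⊙ cs) bs   ≡⟨ cong₂ _⊕_ (sym (⊙-assoc c a b)) (lincomb-⊙ c cs bs) ⟩
    c ⊙ a ⊙ b ⊕ c ⊙ lc cs bs        ≡⟨ ⊙-distribˡ c _ _ ⟨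
    c ⊙ (a ⊙ b ⊕ lc cs bs)          ∎

  lincomb-𝟎 : ∀ {n k} (bs : Vec (Vector 𝔽 n) k) → lc 𝟎 bs ≡ 𝟎
  lincomb-𝟎 []       = refl
  lincomb-𝟎 (b ∷ bs) = trans (cong₂ _⊕_ (⊙-zeroˡ b) (lincomb-𝟎 bs)) (⊕-identityˡ 𝟎)

  lincomb-0∷ : ∀ {n k} (cs : Vector 𝔽 k) b (bs : Vec (Vector 𝔽 n) k) →
    lc (0# ∷ cs) (b ∷ bs) ≡ lc cs bs
  lincomb-0∷ cs b bs = trans (cong (_⊕ lc cs bs) (⊙-zeroˡ b)) (⊕-identityˡ _)

  Span : ∀ {n k} → Vec (Vector 𝔽 n) k → Vector 𝔽 n → Set
  Span = InSpan 𝔽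

  Span-∷ : ∀ {n k} b {bs : Vec (Vector 𝔽 n) k} {v} → Span bs v → Span (b ∷ bs) v
  Span-∷ b {bs} (cs , v≡) = 0# ∷ cs , trans v≡ (sym (lincomb-0∷ cs b bs))

  Span-self : ∀ {n k} (bs : Vec (Vector 𝔽 n) k) → All (Span bs) bs
  Span-self []       = []
  Span-self (b ∷ bs) = (1# ∷ 𝟎 , sym b≡) ∷ All.map (Span-∷ b) (Span-self bs)
    where
    b≡ : 1# ⊙ b ⊕ lc 𝟎 bs ≡ b
    b≡ = trans (cong₂ _⊕_ (⊙-identityˡ b) (lincomb-𝟎 bs)) (⊕-identityʳ b)

  inverseˡ : ∀ c → ¬ c ≡ 0# → ∃ λ d → d *ᶠ c ≡ 1#
  inverseˡ c c≢0 with inverse c c≢0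
  ... | d , cd≡1 = d , trans (*-comm d c) cd≡1

  linIndep-∷ : ∀ {n k} {x : Vector 𝔽 n} {ys : Vec (Vector 𝔽 n) k} →
    LinIndep 𝔽 ys → ¬ Span ys x → LinIndep 𝔽 (x ∷ ys)
  linIndep-∷ {x = x} {ys} ys-indep x∉ys (c ∷ cs) cx+ys≡0 with c ≟ 0#
  ... | yes refl = cong (0# ∷_) (ys-indep cs (trans (sym (lincomb-0∷ cs x ys)) cx+ys≡0))
  ... | no c≢0 with inverseˡ c c≢0
  ... | d , dc≡1 = ⊥-elim (x∉ys ((-ᶠ d) ⊙ cs , x≡))
    where
    x+dys≡0 : x ⊕ d ⊙ lc cs ys ≡ 𝟎
    x+dys≡0 = begin
      x ⊕ d ⊙ lc cs ys                ≡⟨ cong (_⊕ d ⊙ lc cs ys) (⊙-cancel x dc≡1) ⟨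
      d ⊙ c ⊙ x ⊕ d ⊙ lc cs ys        ≡⟨ ⊙-distribˡ d _ _ ⟨
      d ⊙ (c ⊙ x ⊕ lc cs ys)          ≡⟨ cong (d ⊙_) cx+ys≡0 ⟩
      d ⊙ 𝟎                           ≡⟨ ⊙-zeroʳ d ⟩
      𝟎                               ∎
    x≡ : x ≡ lc ((-ᶠ d) ⊙ cs) ys
    x≡ = trans (⊕≡𝟎⇒≡-⊙ d x _ x+dys≡0) (sym (lincomb-⊙ (-ᶠ d) cs ys))

  JointlyIndependent : ∀ {n p r} → Vec (Vector 𝔽 n) p → Vec (Vector 𝔽 n) r → Set
  JointlyIndependent ps us = ∀ cs ds → lc cs ps ⊕ lc ds us ≡ 𝟎 → cs ≡ 𝟎 × ds ≡ 𝟎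

  linIndep⇒jointlyIndependent : ∀ {n r} {us : Vec (Vector 𝔽 n) r} →
    LinIndep 𝔽 us → JointlyIndependent [] us
  linIndep⇒jointlyIndependent us-indep [] ds us≡0 =
    refl , us-indep ds (trans (sym (⊕-identityˡ _)) us≡0)

  jointlyIndependent-moveˡ : ∀ {n p r} {x} {ps : Vec (Vector 𝔽 n) p} {us : Vec _ r} →
    JointlyIndependent ps (x ∷ us) → JointlyIndependent (x ∷ ps) us
  jointlyIndependent-moveˡ {x = x} {ps} {us} indep (c ∷ cs) ds ≡𝟎
    with indep cs (c ∷ ds) (trans (sym (xy∙z≈y∙xz (c ⊙ x) (lc cs ps) (lc ds us))) ≡𝟎)
  ... | cs≡𝟎 , c∷ds≡𝟎 = cong₂ _∷_ (∷-injectiveˡ c∷ds≡𝟎) cs≡𝟎 , ∷-injectiveʳ c∷ds≡𝟎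

  jointlyIndependent-moveʳ : ∀ {n p r} {x} {ps : Vec (Vector 𝔽 n) p} {us : Vec _ r} →
    JointlyIndependent (x ∷ ps) us → JointlyIndependent ps (x ∷ us)
  jointlyIndependent-moveʳ {x = x} {ps} {us} indep cs (c ∷ ds) ≡𝟎
    with indep (c ∷ cs) ds (trans (xy∙z≈y∙xz (c ⊙ x) (lc cs ps) (lc ds us)) ≡𝟎)
  ... | c∷cs≡𝟎 , ds≡𝟎 = ∷-injectiveʳ c∷cs≡𝟎 , cong₂ _∷_ (∷-injectiveˡ c∷cs≡𝟎) ds≡𝟎

  jointlyIndependent-head≢𝟎 : ∀ {n p r} {x} {ps : Vec (Vector 𝔽 n) p} {us : Vec _ r} →
    JointlyIndependent ps (x ∷ us) → ¬ x ≡ 𝟎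
  jointlyIndependent-head≢𝟎 {ps = ps} {us} indep refl =
    0≢1 (sym (∷-injectiveˡ (proj₂ (indep 𝟎 (1# ∷ 𝟎) ≡𝟎))))
    where
    ≡𝟎 : lc 𝟎 ps ⊕ (1# ⊙ 𝟎 ⊕ lc 𝟎 us) ≡ 𝟎
    ≡𝟎 = begin
      lc 𝟎 ps ⊕ (1# ⊙ 𝟎 ⊕ lc 𝟎 us)   ≡⟨ cong₂ _⊕_ (lincomb-𝟎 ps) (cong₂ _⊕_ (⊙-zeroʳ 1#) (lincomb-𝟎 us)) ⟩
      𝟎 ⊕ (𝟎 ⊕ 𝟎)                   ≡⟨ trans (⊕-identityˡ _) (⊕-identityˡ _) ⟩
      𝟎                             ∎

  shear : ∀ {n r} → Vector 𝔽 n → Vector 𝔽 r → Vec (Vector 𝔽 n) r → Vec (Vector 𝔽 n) r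
  shear x = zipWith (λ t y → y ⊕ t ⊙ x)

  dot : ∀ {k} → Vector 𝔽 k → Vector 𝔽 k → Carrier
  dot []       []       = 0#
  dot (d ∷ ds) (t ∷ ts) = d *ᶠ t +ᶠ dot ds ts

  lincomb-shear : ∀ {n r} x (ds ts : Vector 𝔽 r) (us : Vec (Vector 𝔽 n) r) →
    lc ds (shear x ts us) ≡ lc (dot ds ts ∷ ds) (x ∷ us)
  lincomb-shear x []       []       []       = sym (trans (⊕-identityʳ _) (⊙-zeroˡ x))
  lincomb-shear x (d ∷ ds) (t ∷ ts) (y ∷ us) = begin
    d ⊙ (y ⊕ t ⊙ x) ⊕ lc ds (shear x ts us)
      ≡⟨ cong₂ _⊕_ (trans (⊙-distribˡ d y _) (cong (d ⊙ y ⊕_) (⊙-assoc d t x))) (lincomb-shear x ds ts us) ⟩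
    (d ⊙ y ⊕ (d *ᶠ t) ⊙ x) ⊕ (e ⊙ x ⊕ lc ds us)
      ≡⟨ cong (_⊕ (e ⊙ x ⊕ lc ds us)) (⊕-comm _ _) ⟩
    ((d *ᶠ t) ⊙ x ⊕ d ⊙ y) ⊕ (e ⊙ x ⊕ lc ds us)
      ≡⟨ interchange _ _ _ _ ⟩
    ((d *ᶠ t) ⊙ x ⊕ e ⊙ x) ⊕ (d ⊙ y ⊕ lc ds us)
      ≡⟨ cong (_⊕ (d ⊙ y ⊕ lc ds us)) (⊙-distribʳ _ _ x) ⟨
    (d *ᶠ t +ᶠ e) ⊙ x ⊕ (d ⊙ y ⊕ lc ds us)
      ∎
    where
    e = dot ds ts

  jointlyIndependent-shear : ∀ {n p r} {x} {ps : Vec (Vector 𝔽 n) p} {us : Vec _ r} ts →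
    JointlyIndependent ps (x ∷ us) → JointlyIndependent ps (shear x ts us)
  jointlyIndependent-shear {x = x} {ps} {us} ts indep cs ds ≡𝟎
    with indep cs (dot ds ts ∷ ds) (trans (cong (lc cs ps ⊕_) (sym (lincomb-shear x ds ts us))) ≡𝟎)
  ... | cs≡𝟎 , e∷ds≡𝟎 = cs≡𝟎 , ∷-injectiveʳ e∷ds≡𝟎

  -- Gaussian elimination of the b-coordinate against a pivot x whose b-coordinate a is nonzero.
  eliminate : ∀ {n k r} {a as b} {bs : Vec (Vector 𝔽 n) k} {x} {us : Vec _ r} →
    ¬ a ≡ 0# → x ≡ lc (a ∷ as) (b ∷ bs) → All (Span (b ∷ bs)) us →
    ∃ λ ts → All (Span bs) (shear x ts us)
  eliminate {a = a} {as} {b} {bs} {x} a≢0 x≡ = go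
    where
    ai = proj₁ (inverseˡ a a≢0)

    pivot : ∀ c → c +ᶠ ((-ᶠ c) *ᶠ ai) *ᶠ a ≡ 0#
    pivot c = begin
      c +ᶠ ((-ᶠ c) *ᶠ ai) *ᶠ a   ≡⟨ cong (c +ᶠ_) (*-assoc (-ᶠ c) ai a) ⟩
      c +ᶠ (-ᶠ c) *ᶠ (ai *ᶠ a)   ≡⟨ cong (λ z → c +ᶠ (-ᶠ c) *ᶠ z) (proj₂ (inverseˡ a a≢0)) ⟩
      c +ᶠ (-ᶠ c) *ᶠ 1#          ≡⟨ cong (c +ᶠ_) (*-identityʳ (-ᶠ c)) ⟩
      c +ᶠ (-ᶠ c)                ≡⟨ -‿inverseʳ c ⟩
      0#                         ∎

    eliminate₁ : ∀ {y} → Span (b ∷ bs) y → ∃ λ t → Span bs (y ⊕ t ⊙ x)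
    eliminate₁ {y} (c ∷ cs , y≡) = t , cs ⊕ t ⊙ as , (begin
      y ⊕ t ⊙ x                                  ≡⟨ cong₂ (λ y x → y ⊕ t ⊙ x) y≡ x≡ ⟩
      lc (c ∷ cs) (b ∷ bs) ⊕ t ⊙ lc (a ∷ as) (b ∷ bs)
        ≡⟨ cong (lc (c ∷ cs) (b ∷ bs) ⊕_) (lincomb-⊙ t (a ∷ as) (b ∷ bs)) ⟨
      lc (c ∷ cs) (b ∷ bs) ⊕ lc (t ⊙ (a ∷ as)) (b ∷ bs)
        ≡⟨ lincomb-⊕ (c ∷ cs) (t ⊙ (a ∷ as)) (b ∷ bs) ⟨
      lc ((c +ᶠ t *ᶠ a) ∷ (cs ⊕ t ⊙ as)) (b ∷ bs)
        ≡⟨ cong (λ z → lc (z ∷ (cs ⊕ t ⊙ as)) (b ∷ bs)) (pivot c) ⟩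
      lc (0# ∷ (cs ⊕ t ⊙ as)) (b ∷ bs)           ≡⟨ lincomb-0∷ (cs ⊕ t ⊙ as) b bs ⟩
      lc (cs ⊕ t ⊙ as) bs                        ∎)
      where
      t = (-ᶠ c) *ᶠ ai

    go : ∀ {r} {us : Vec _ r} → All (Span (b ∷ bs)) us → ∃ λ ts → All (Span bs) (shear x ts us)
    go []            = [] , []
    go (y∈ ∷ us∈) with eliminate₁ y∈ | go us∈
    ... | t , y′∈ | ts , us′∈ = t ∷ ts , y′∈ ∷ us′∈

  -- Steinitz exchange, by induction on the spanning family b ∷ bs.  After gathering everything
  -- into us, walk keeps ps inside the span of bs: a vector of us with zero b-coordinate is moved to
  -- ps, and the first one with a nonzero b-coordinate is a pivot eliminating b from the others.
  jointlyIndependent-length≤ : ∀ {n k p r} (bs : Vec (Vector 𝔽 n) k)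
    (ps : Vec (Vector 𝔽 n) p) (us : Vec (Vector 𝔽 n) r) →
    JointlyIndependent ps us → All (Span bs) ps → All (Span bs) us → p + r ≤ k
  jointlyIndependent-length≤ [] []       []       _     _                  _ = z≤n
  jointlyIndependent-length≤ [] _        (_ ∷ _)  indep _ (([] , u≡𝟎) ∷ _) =
    ⊥-elim (jointlyIndependent-head≢𝟎 indep u≡𝟎)
  jointlyIndependent-length≤ [] (_ ∷ _)  []       indep (([] , p≡𝟎) ∷ _) _ =
    ⊥-elim (jointlyIndependent-head≢𝟎 (jointlyIndependent-moveʳ indep) p≡𝟎)
  jointlyIndependent-length≤ {k = suc k} (b ∷ bs) = gather
    where
    walk : ∀ {p r} (ps : Vec _ p) (us : Vec _ r) → JointlyIndependent ps us →
      All (Span bs) ps → All (Span (b ∷ bs)) us → p + r ≤ suc k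
    walk ps [] indep ps∈ _ = ℕ.m≤n⇒m≤1+n (jointlyIndependent-length≤ bs ps [] indep ps∈ [])
    walk {p} {suc r} ps (u ∷ us) indep ps∈ ((a ∷ as , u≡) ∷ us∈) with a ≟ 0#
    ... | yes refl = subst (_≤ suc k) (sym (ℕ.+-suc p r))
      (walk (u ∷ ps) us (jointlyIndependent-moveˡ indep) ((as , trans u≡ (lincomb-0∷ as b bs)) ∷ ps∈) us∈)
    ... | no a≢0 with eliminate {as = as} {b} {bs} a≢0 u≡ us∈
    ... | ts , us′∈ = subst (_≤ suc k) (sym (ℕ.+-suc p r))
      (s≤s (jointlyIndependent-length≤ bs ps (shear u ts us) (jointlyIndependent-shear ts indep) ps∈ us′∈))

    gather : ∀ {p r} (ps : Vec _ p) (us : Vec _ r) → JointlyIndependent ps us →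
      All (Span (b ∷ bs)) ps → All (Span (b ∷ bs)) us → p + r ≤ suc k
    gather []       us indep _           us∈ = walk [] us indep [] us∈
    gather {suc p} {r} (x ∷ ps) us indep (x∈ ∷ ps∈) us∈ = subst (_≤ suc k) (ℕ.+-suc p r)
      (gather ps (x ∷ us) (jointlyIndependent-moveʳ indep) ps∈ (x∈ ∷ us∈))

  linIndep-length≤ : ∀ {n k r} {bs : Vec (Vector 𝔽 n) k} {xs : Vec (Vector 𝔽 n) r} →
    LinIndep 𝔽 xs → All (Span bs) xs → r ≤ k
  linIndep-length≤ {bs = bs} {xs} indep xs∈ =
    jointlyIndependent-length≤ bs [] xs (linIndep⇒jointlyIndependent indep) [] xs∈

  ∃-dec : {P : Carrier → Set} → (∀ x → Dec (P x)) → Dec (∃ P)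
  ∃-dec P? = map′ satisfied (λ (x , px) → lose (complete x) px) (any? P? elements)

  ∃ᵛ-dec : ∀ {k} {P : Vector 𝔽 k → Set} → (∀ cs → Dec (P cs)) → Dec (∃ P)
  ∃ᵛ-dec {zero}  P? = map′ ([] ,_) (λ { ([] , p) → p }) (P? [])
  ∃ᵛ-dec {suc k} P? = map′ (λ (x , cs , p) → x ∷ cs , p) (λ { (x ∷ cs , p) → x , cs , p })
    (∃-dec λ x → ∃ᵛ-dec λ cs → P? (x ∷ cs))

  Span? : ∀ {n k} (bs : Vec (Vector 𝔽 n) k) v → Dec (Span bs v)
  Span? bs v = ∃ᵛ-dec λ cs → ≡-dec _≟_ v (lc cs bs)

  Mem? : ∀ {n d} {V : Subspace 𝔽 n} → HasDim 𝔽 V d → ∀ v → Dec (Mem V v)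
  Mem? (bs , _ , V≡⟨bs⟩) v = map′ (proj₂ (V≡⟨bs⟩ v)) (proj₁ (V≡⟨bs⟩ v)) (Span? bs v)

  linIndep-length≤dim : ∀ {n d r} {V : Subspace 𝔽 n} {xs : Vec (Vector 𝔽 n) r} →
    HasDim 𝔽 V d → LinIndep 𝔽 xs → All (Mem V) xs → r ≤ d
  linIndep-length≤dim (_ , _ , V≡⟨bs⟩) indep xs∈V =
    linIndep-length≤ indep (All.map (λ {v} → proj₁ (V≡⟨bs⟩ v)) xs∈V)

  ⊆∧sameDim⇒⊇ : ∀ {n d} {U V : Subspace 𝔽 n} →
    _⊆_ 𝔽 U V → HasDim 𝔽 U d → HasDim 𝔽 V d → _⊆_ 𝔽 V U
  ⊆∧sameDim⇒⊇ {U = U} {V} U⊆V dimU@(bs , bs-indep , U≡⟨bs⟩) dimV v v∈V with Mem? {V = U} dimU v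
  ... | yes v∈U = v∈U
  ... | no  v∉U = ⊥-elim (ℕ.<-irrefl refl (linIndep-length≤dim {V = V} dimV v∷bs-indep (v∈V ∷ bs⊆V)))
    where
    v∷bs-indep : LinIndep 𝔽 (v ∷ bs)
    v∷bs-indep = linIndep-∷ bs-indep (λ v∈⟨bs⟩ → v∉U (proj₂ (U≡⟨bs⟩ v) v∈⟨bs⟩))
    bs⊆V : All (Mem V) bs
    bs⊆V = All.map (λ {b} b∈⟨bs⟩ → U⊆V b (proj₂ (U≡⟨bs⟩ b) b∈⟨bs⟩)) (Span-self bs)

  _+⟨_⟩ : ∀ {n} → Subspace 𝔽 n → Vector 𝔽 n → Subspace 𝔽 n
  W +⟨ w ⟩ = record
    { Mem   = λ v → ∃ λ x → ∃ λ c → Mem W x × v ≡ x ⊕ c ⊙ w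
    ; mem-0 = 𝟎 , 0# , mem-0 W , sym (trans (⊕-identityˡ _) (⊙-zeroˡ w))
    ; mem-+ = λ { (x , c , x∈W , refl) (y , d , y∈W , refl) →
        x ⊕ y , c +ᶠ d , mem-+ W x∈W y∈W ,
        trans (interchange x _ y _) (cong (x ⊕ y ⊕_) (sym (⊙-distribʳ c d w))) }
    ; mem-· = λ { e (x , c , x∈W , refl) →
        e ⊙ x , e *ᶠ c , mem-· W e x∈W ,
        trans (⊙-distribˡ e x _) (cong (e ⊙ x ⊕_) (⊙-assoc e c w)) }
    }

  ⊆-+⟨⟩ : ∀ {n} {W : Subspace 𝔽 n} {w} → _⊆_ 𝔽 W (W +⟨ w ⟩)
  ⊆-+⟨⟩ {w = w} x x∈W = x , 0# , x∈W , sym (trans (cong (x ⊕_) (⊙-zeroˡ w)) (⊕-identityʳ x))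

  ∈-+⟨⟩ : ∀ {n} {W : Subspace 𝔽 n} {w} → Mem (W +⟨ w ⟩) w
  ∈-+⟨⟩ {W = W} {w} = 𝟎 , 1# , mem-0 W , sym (trans (⊕-identityˡ _) (⊙-identityˡ w))

  +⟨⟩-⊆ : ∀ {n} {W V : Subspace 𝔽 n} {w} → _⊆_ 𝔽 W V → Mem V w → _⊆_ 𝔽 (W +⟨ w ⟩) V
  +⟨⟩-⊆ {V = V} W⊆V w∈V _ (x , c , x∈W , refl) = mem-+ V (W⊆V x x∈W) (mem-· V c w∈V)

  +⟨⟩-hasDim : ∀ {n d} {W : Subspace 𝔽 n} {w} →
    HasDim 𝔽 W d → ¬ Mem W w → HasDim 𝔽 (W +⟨ w ⟩) (suc d)
  +⟨⟩-hasDim {W = W} {w} (bs , bs-indep , W≡⟨bs⟩) w∉W =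
    w ∷ bs , linIndep-∷ bs-indep (λ w∈⟨bs⟩ → w∉W (proj₂ (W≡⟨bs⟩ w) w∈⟨bs⟩)) , λ v → to v , from v
    where
    to : ∀ v → Mem (W +⟨ w ⟩) v → Span (w ∷ bs) v
    to v (x , c , x∈W , v≡) with proj₁ (W≡⟨bs⟩ x) x∈W
    ... | cs , refl = c ∷ cs , trans v≡ (⊕-comm _ _)
    from : ∀ v → Span (w ∷ bs) v → Mem (W +⟨ w ⟩) v
    from v (c ∷ cs , v≡) = lc cs bs , c , proj₂ (W≡⟨bs⟩ _) (cs , refl) , trans v≡ (⊕-comm _ _)

  mem-⊙⁻¹ : ∀ {n} {W : Subspace 𝔽 n} {c u} → ¬ c ≡ 0# → Mem W (c ⊙ u) → Mem W u
  mem-⊙⁻¹ {W = W} {c} {u} c≢0 cu∈W with inverseˡ c c≢0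
  ... | d , dc≡1 = subst (Mem W) (⊙-cancel u dc≡1) (mem-· W d cu∈W)

  isDirectSumLine : ∀ {n d} {W V : Subspace 𝔽 n} {u} →
    _⊆_ 𝔽 W V → HasDim 𝔽 W d → HasDim 𝔽 V (suc d) → Mem V u → ¬ Mem W u →
    IsDirectSumLine 𝔽 V W u
  isDirectSumLine {W = W} {V} {u} W⊆V dimW dimV u∈V u∉W =
    ⊆∧sameDim⇒⊇ {U = W +⟨ u ⟩} {V} W+u⊆V (+⟨⟩-hasDim {W = W} dimW u∉W) dimV ,
    (λ x c x∈W → W+u⊆V (x ⊕ c ⊙ u) (x , c , x∈W , refl)) ,
    line∩W≡𝟎
    where
    W+u⊆V : _⊆_ 𝔽 (W +⟨ u ⟩) V
    W+u⊆V = +⟨⟩-⊆ {W = W} {V} W⊆V u∈V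
    line∩W≡𝟎 : ∀ c → Mem W (c ⊙ u) → c ⊙ u ≡ 𝟎
    line∩W≡𝟎 c cu∈W with c ≟ 0#
    ... | yes refl = ⊙-zeroˡ u
    ... | no  c≢0  = ⊥-elim (u∉W (mem-⊙⁻¹ {W = W} c≢0 cu∈W))

module LexOrder (𝔽 : FiniteField) (O : AdmissibleOrder 𝔽) where
  open AdmissibleOrder O
  open IsStrictTotalOrder isStrictTotalOrder using () renaming (trans to ≺-trans; irrefl to ≺-irrefl)
  open VectorSpace 𝔽

  ≺v-trans : ∀ {n} {x y z : Vector 𝔽 n} → _≺v_ 𝔽 O x y → _≺v_ 𝔽 O y z → _≺v_ 𝔽 O x z
  ≺v-trans {x = []}    {[]}    {[]}    ()
  ≺v-trans {x = _ ∷ _} {_ ∷ _} {_ ∷ _} (inj₁ a≺b)          (inj₁ b≺c)          = inj₁ (≺-trans a≺b b≺c)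
  ≺v-trans {x = _ ∷ _} {_ ∷ _} {_ ∷ _} (inj₁ a≺b)          (inj₂ (refl , _))   = inj₁ a≺b
  ≺v-trans {x = _ ∷ _} {_ ∷ _} {_ ∷ _} (inj₂ (refl , _))   (inj₁ b≺c)          = inj₁ b≺c
  ≺v-trans {x = _ ∷ _} {_ ∷ _} {_ ∷ _} (inj₂ (refl , x≺y)) (inj₂ (refl , y≺z)) = inj₂ (refl , ≺v-trans x≺y y≺z)

  ≺v-irrefl : ∀ {n} (x : Vector 𝔽 n) → ¬ _≺v_ 𝔽 O x x
  ≺v-irrefl (a ∷ x) (inj₁ a≺a)       = ≺-irrefl refl a≺a
  ≺v-irrefl (a ∷ x) (inj₂ (_ , x≺x)) = ≺v-irrefl x x≺x

  ≺v-⪯v-trans : ∀ {n} {x y z : Vector 𝔽 n} → _≺v_ 𝔽 O x y → _⪯v_ 𝔽 O y z → _≺v_ 𝔽 O x z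
  ≺v-⪯v-trans x≺y (inj₁ y≺z) = ≺v-trans x≺y y≺z
  ≺v-⪯v-trans x≺y (inj₂ refl) = x≺y

  ⪯v-≺v-trans : ∀ {n} {x y z : Vector 𝔽 n} → _⪯v_ 𝔽 O x y → _≺v_ 𝔽 O y z → _≺v_ 𝔽 O x z
  ⪯v-≺v-trans (inj₁ x≺y) y≺z = ≺v-trans x≺y y≺z
  ⪯v-≺v-trans (inj₂ refl) y≺z = y≺z

  IsLeastBetween : ∀ {n} → ℕ → Subspace 𝔽 n → Subspace 𝔽 n → Subspace 𝔽 n → Set₁
  IsLeastBetween {n} d W V″ V′ = (F : Subspace 𝔽 n) →
    _⊆_ 𝔽 W F → _⊆_ 𝔽 F V″ → HasDim 𝔽 F d → _≐_ 𝔽 V′ F ⊎ _≺q_ 𝔽 O V′ F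

  leastBetween-precedes : ∀ {n j} {W V′ V″ : Subspace 𝔽 n} {w} →
    _⊆_ 𝔽 W V′ → _⊆_ 𝔽 W V″ → HasDim 𝔽 W j → IsLeastBetween (suc j) W V″ V′ →
    Mem V″ w → ¬ Mem V′ w → ∃ λ a → _∖_ 𝔽 V′ W a × _≺v_ 𝔽 O a w
  leastBetween-precedes {W = W} {V′} {V″} {w} W⊆V′ W⊆V″ dimW V′-least w∈V″ w∉V′
    with V′-least (W +⟨ w ⟩) (⊆-+⟨⟩ {W = W}) (+⟨⟩-⊆ {W = W} {V″} W⊆V″ w∈V″)
                  (+⟨⟩-hasDim {W = W} dimW (λ w∈W → w∉V′ (W⊆V′ w w∈W)))
  ... | inj₁ (_ , W+w⊆V′) = ⊥-elim (w∉V′ (W+w⊆V′ w (∈-+⟨⟩ {W = W})))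
  ... | inj₂ (a , b , ((a∈V′ , a∉W+w) , _) , (_ , b-least) , a≺b) =
    a , (a∈V′ , λ a∈W → a∉W+w (⊆-+⟨⟩ {W = W} a a∈W)) , ≺v-⪯v-trans a≺b (b-least w (∈-+⟨⟩ {W = W} , w∉V′))

module Chain (𝔽 : FiniteField) (O : AdmissibleOrder 𝔽) {n s s₁ : ℕ}
  (V : ℕ → Subspace 𝔽 n)
  (V-dim : ∀ i → s₁ ≤ i → i ≤ s → HasDim 𝔽 (V i) i)
  (V-step : ∀ i → s₁ ≤ i → i < s → _⊆_ 𝔽 (V i) (V (suc i)))
  (V-least : ∀ j → s₁ ≤ j → suc j < s →
    LexOrder.IsLeastBetween 𝔽 O (suc j) (V j) (V (suc (suc j))) (V (suc j)))
  (u : ℕ → Vector 𝔽 n)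
  (u-min : ∀ j → s₁ ≤ j → suc j ≤ s → IsMin 𝔽 O (_∖_ 𝔽 (V s) (V j)) (u (suc j)))
  where
  open VectorSpace 𝔽
  open LexOrder 𝔽 O

  V-mono′ : ∀ {i j} → s₁ ≤ i → i ≤′ j → j ≤ s → _⊆_ 𝔽 (V i) (V j)
  V-mono′ _    ≤′-refl          _     _ v∈V = v∈V
  V-mono′ s₁≤i (≤′-step i≤′j) 1+j≤s v v∈V =
    V-step _ (ℕ.≤-trans s₁≤i (ℕ.≤′⇒≤ i≤′j)) 1+j≤s v (V-mono′ s₁≤i i≤′j (ℕ.<⇒≤ 1+j≤s) v v∈V)

  V-mono : ∀ {i j} → s₁ ≤ i → i ≤ j → j ≤ s → _⊆_ 𝔽 (V i) (V j)
  V-mono s₁≤i i≤j = V-mono′ s₁≤i (ℕ.≤⇒≤′ i≤j)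

  u-descends : ∀ {a j} → s₁ ≤ a → a ≤ j → suc (suc j) ≤ s →
    Mem (V (suc (suc j))) (u (suc a)) → Mem (V (suc j)) (u (suc a))
  u-descends {a} {j} s₁≤a a≤j 2+j≤s u∈V₂ =
    decidable-stable (Mem? {V = V (suc j)} (V-dim (suc j) s₁≤1+j 1+j≤s) (u (suc a))) ¬u∉V₁
    where
    s₁≤j = ℕ.≤-trans s₁≤a a≤j
    s₁≤1+j = ℕ.m≤n⇒m≤1+n s₁≤j
    1+j≤s = ℕ.<⇒≤ 2+j≤s
    j≤s = ℕ.<⇒≤ 1+j≤s

    ¬u∉V₁ : ¬ ¬ Mem (V (suc j)) (u (suc a))
    ¬u∉V₁ u∉V₁ with leastBetween-precedes {W = V j} {V (suc j)} {V (suc (suc j))}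
      (V-step j s₁≤j 1+j≤s) (V-mono s₁≤j (ℕ.m≤n+m j 2) 2+j≤s) (V-dim j s₁≤j j≤s)
      (V-least j s₁≤j 2+j≤s) u∈V₂ u∉V₁
    ... | b , (b∈V₁ , b∉V₀) , b≺u = ≺v-irrefl _ (⪯v-≺v-trans u⪯b b≺u)
      where
      u⪯b = proj₂ (u-min a s₁≤a (ℕ.≤-trans (s≤s a≤j) 1+j≤s)) b
        (V-mono s₁≤1+j 1+j≤s ℕ.≤-refl b b∈V₁ , λ b∈Vₐ → b∉V₀ (V-mono s₁≤a a≤j j≤s b b∈Vₐ))

  u∈V-above : ∀ {a t} → s₁ ≤ a → a < t → t ≤‴ s → Mem (V t) (u (suc a))
  u∈V-above {a} s₁≤a a<s ≤‴-refl = proj₁ (proj₁ (u-min a s₁≤a a<s))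
  u∈V-above {t = suc j} s₁≤a (s≤s a≤j) (≤‴-step 2+j≤‴s) =
    u-descends s₁≤a a≤j (ℕ.≤‴⇒≤ 2+j≤‴s) (u∈V-above s₁≤a (s≤s (ℕ.m≤n⇒m≤1+n a≤j)) 2+j≤‴s)

  u∈V : ∀ {a} → s₁ ≤ a → suc a ≤ s → Mem (V (suc a)) (u (suc a))
  u∈V s₁≤a a<s = u∈V-above s₁≤a ℕ.≤-refl (ℕ.≤⇒≤‴ a<s)

  u-isMin : ∀ j → s₁ ≤ j → suc j < s → IsMin 𝔽 O (_∖_ 𝔽 (V (suc j)) (V j)) (u (suc j))
  u-isMin j s₁≤j 1+j<s = (u∈V s₁≤j 1+j≤s , proj₂ (proj₁ min)) ,
    λ y (y∈V₁ , y∉V₀) → proj₂ min y (V-mono (ℕ.m≤n⇒m≤1+n s₁≤j) 1+j≤s ℕ.≤-refl y y∈V₁ , y∉V₀)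
    where
    1+j≤s = ℕ.<⇒≤ 1+j<s
    min = u-min j s₁≤j 1+j≤s

  u-directSum : ∀ j → s₁ ≤ j → suc j < s → IsDirectSumLine 𝔽 (V (suc j)) (V j) (u (suc j))
  u-directSum j s₁≤j 1+j<s = isDirectSumLine {W = V j} {V (suc j)}
    (V-step j s₁≤j 1+j≤s) (V-dim j s₁≤j (ℕ.<⇒≤ 1+j≤s)) (V-dim (suc j) (ℕ.m≤n⇒m≤1+n s₁≤j) 1+j≤s)
    (u∈V s₁≤j 1+j≤s) (proj₂ (proj₁ (u-min j s₁≤j 1+j≤s)))
    where
    1+j≤s = ℕ.<⇒≤ 1+j<s

  u-increasing : ∀ j → s₁ ≤ j → suc (suc j) ≤ s → _≺v_ 𝔽 O (u (suc j)) (u (suc (suc j)))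
  u-increasing j s₁≤j 2+j≤s with proj₂ (u-min j s₁≤j 1+j≤s) (u (suc (suc j))) (u′∈Vₛ , u′∉V₀)
    where
    1+j≤s = ℕ.<⇒≤ 2+j≤s
    u′∈Vₛ = proj₁ (proj₁ (u-min (suc j) (ℕ.m≤n⇒m≤1+n s₁≤j) 2+j≤s))
    u′∉V₁ = proj₂ (proj₁ (u-min (suc j) (ℕ.m≤n⇒m≤1+n s₁≤j) 2+j≤s))
    u′∉V₀ = λ u′∈V₀ → u′∉V₁ (V-step j s₁≤j 1+j≤s _ u′∈V₀)
  ... | inj₁ u≺u′ = u≺u′
  ... | inj₂ u≡u′ = ⊥-elim (proj₂ (proj₁ (u-min (suc j) (ℕ.m≤n⇒m≤1+n s₁≤j) 2+j≤s))
    (subst (Mem (V (suc j))) u≡u′ (u∈V s₁≤j (ℕ.<⇒≤ 2+j≤s))))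

lemma2p15 : (𝔽 : FiniteField) (O : AdmissibleOrder 𝔽) (n s s₁ : ℕ) →
    s₁ + 2 ≤ s →
    (V : ℕ → Subspace 𝔽 n) →
    (∀ i → s₁ ≤ i → i ≤ s → HasDim 𝔽 (V i) i) →
    (∀ i → s₁ ≤ i → i < s → _⊆_ 𝔽 (V i) (V (suc i))) →
    (∀ j → s₁ ≤ j → suc j < s → (F : Subspace 𝔽 n) →
      _⊆_ 𝔽 (V j) F → _⊆_ 𝔽 F (V (suc (suc j))) → HasDim 𝔽 F (suc j) →
      _≐_ 𝔽 (V (suc j)) F ⊎ _≺q_ 𝔽 O (V (suc j)) F) →
    (u : ℕ → Vec (FiniteField.Carrier 𝔽) n) →
    (∀ j → s₁ ≤ j → suc j ≤ s → IsMin 𝔽 O (_∖_ 𝔽 (V s) (V j)) (u (suc j))) →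
    (∀ j → s₁ ≤ j → suc j < s →
      IsMin 𝔽 O (_∖_ 𝔽 (V (suc j)) (V j)) (u (suc j)) ×
      IsDirectSumLine 𝔽 (V (suc j)) (V j) (u (suc j)))
    × (∀ j → s₁ ≤ j → suc (suc j) ≤ s → _≺v_ 𝔽 O (u (suc j)) (u (suc (suc j))))
-- The hypothesis s₁ + 2 ≤ s only keeps the ranges of the conclusion nonempty.
lemma2p15 𝔽 O n s s₁ _ V V-dim V-step V-least u u-min =
  (λ j s₁≤j 1+j<s → u-isMin j s₁≤j 1+j<s , u-directSum j s₁≤j 1+j<s) , u-increasing
  where
  open Chain 𝔽 O V V-dim V-step V-least u u-min
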